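{- $(\downarrow\! 1)_\ast = (1 \cup 1_{\Cup})_\ast = \Omega^{\smile}$, and thus $\downarrow\! R = R \ast \downarrow\! 1$ for all $R : X \leftrightarrow \mathcal{P} Y$.
   Context: A multirelation is a binary relation $X \leftrightarrow \mathcal{P} Y$; juxtaposition denotes relational composition and $R^{\smile}$ denotes the converse of $R$. $1 = \{(b,\{b\}) \mid b \in Y\}$ and $1_{\Cup} = \{(a,\emptyset) \mid a \in X\}$. $\Omega = \{(A,B) \mid A \subseteq B \subseteq Y\}$ is the subset relation, so $\Omega^{\smile} = \{(A,B) \mid B \subseteq A\}$. The inner down-closure is $\downarrow\! R = R\,\Omega^{\smile} = \{(a,A) \mid \exists (a,B) \in R.\ A \subseteq B\}$. The Peleg lifting of $S : X \leftrightarrow \mathcal{P} Y$ is $S_\ast = \{(A,B) \mid \exists f : X \to \mathcal{P} Y.\ f|_A \subseteq S \wedge B = \bigcup f(A)\}$, and Peleg composition is $R \ast S = R\, S_\ast$. -}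

module Defs where

open import Level using (Level; 0ℓ) renaming (suc to lsuc)
open import Data.Product using (Σ; ∃; _×_; _,_)
open import Data.Sum using (_⊎_)
open import Data.Empty using (⊥)
open import Relation.Binary.PropositionalEquality using (_≡_)

𝒫 : Set → Set₁
𝒫 Y = Y → Set

_∈_ : {Y : Set} → Y → 𝒫 Y → Set
y ∈ A = A y

_⊆_ : {Y : Set} → 𝒫 Y → 𝒫 Y → Set
A ⊆ B = ∀ y → y ∈ A → y ∈ B

_≐_ : {Y : Set} → 𝒫 Y → 𝒫 Y → Set
A ≐ B = A ⊆ B × B ⊆ A

∅ : {Y : Set} → 𝒫 Y
∅ _ = ⊥

｛_｝ : {Y : Set} → Y → 𝒫 Y
｛ b ｝ y = y ≡ b

⋃ : {X Y : Set} → 𝒫 X → (X → 𝒫 Y) → 𝒫 Y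
⋃ A f y = Σ _ λ a → a ∈ A × y ∈ f a

-- Binary relations A ↔ B (valued in Set₁, since they may quantify over subsets)
_↔_ : ∀ {a b} → Set a → Set b → Set (a Level.⊔ b Level.⊔ lsuc (lsuc 0ℓ))
A ↔ B = A → B → Set₁

MRel : Set → Set → Set₂
MRel X Y = X ↔ 𝒫 Y

-- relational composition (juxtaposition in the paper)
_⨾_ : ∀ {a c} {A : Set a} {B : Set₁} {C : Set c} → A ↔ B → B ↔ C → A ↔ C
(R ⨾ S) x z = Σ _ λ y → R x y × S y z

_⌣ : ∀ {a b} {A : Set a} {B : Set b} → A ↔ B → B ↔ A
(R ⌣) y x = R x y

_∪_ : ∀ {a b} {A : Set a} {B : Set b} → A ↔ B → A ↔ B → A ↔ B
(R ∪ S) x y = R x y ⊎ S x y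

_≡ᴿ_ : ∀ {a b} {A : Set a} {B : Set b} → A ↔ B → A ↔ B → Set (a Level.⊔ b Level.⊔ lsuc 0ℓ)
R ≡ᴿ S = ∀ x y → (R x y → S x y) × (S x y → R x y)

𝟏 : {Y : Set} → MRel Y Y
𝟏 b A = Level.Lift _ (A ≐ ｛ b ｝)

𝟏⋓ : {X Y : Set} → MRel X Y
𝟏⋓ a A = Level.Lift _ (A ≐ ∅)

Ω : {Y : Set} → 𝒫 Y ↔ 𝒫 Y
Ω A B = Level.Lift _ (A ⊆ B)

↓ : {X Y : Set} → MRel X Y → MRel X Y
↓ R = R ⨾ (Ω ⌣)

_∗ : {X Y : Set} → MRel X Y → 𝒫 X ↔ 𝒫 Y
(S ∗) A B = Σ (_ → 𝒫 _) λ f → (∀ a → a ∈ A → S a (f a)) × Level.Lift (Level.suc 0ℓ) (B ≐ ⋃ A f)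

_✶_ : {X Y Z : Set} → MRel X Y → MRel Y Z → MRel X Z
R ✶ S = R ⨾ (S ∗)

infix 4 _≡ᴿ_
infixl 6 _∪_
infixl 7 _⨾_ _✶_
infix 9 _∗ _⌣

{-# OPTIONS --safe #-}
module Submission where

open import Defs
open import Data.Product using (_×_; _,_; proj₁; proj₂)
open import Data.Sum using (inj₁; inj₂)
open import Data.Empty using (⊥-elim)
open import Level using (0ℓ; lift)
open import Axiom.ExcludedMiddle using (ExcludedMiddle)
open import Relation.Nullary using (yes; no)
open import Relation.Binary.PropositionalEquality using (refl; subst; sym)

-- Both liftings equal Ω⌣ because each of ↓1 and 1 ∪ 1⋓ relates a to exactly the
-- subsets of {a} (for 1 ∪ 1⋓ this needs excluded middle). Such a lifting can only
-- shrink A, and any B ⊆ A is reached by sending a to {a} ∩ B. The last identity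
-- is then ↓R = R Ω⌣ = R (↓1)∗.

≡ᴿ-sym : ∀ {a b} {A : Set a} {B : Set b} {R S : A ↔ B} → R ≡ᴿ S → S ≡ᴿ R
≡ᴿ-sym R≡S x y = proj₂ (R≡S x y) , proj₁ (R≡S x y)

≡ᴿ-trans : ∀ {a b} {A : Set a} {B : Set b} {R S T : A ↔ B} →
           R ≡ᴿ S → S ≡ᴿ T → R ≡ᴿ T
≡ᴿ-trans R≡S S≡T x y =
    (λ r → proj₁ (S≡T x y) (proj₁ (R≡S x y) r))
  , (λ t → proj₂ (R≡S x y) (proj₂ (S≡T x y) t))

⨾-congˡ : ∀ {a c} {A : Set a} {B : Set₁} {C : Set c} (R : A ↔ B) {S T : B ↔ C} →
          S ≡ᴿ T → R ⨾ S ≡ᴿ R ⨾ T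
⨾-congˡ R S≡T x z =
    (λ { (y , r , s) → y , r , proj₁ (S≡T y z) s })
  , (λ { (y , r , t) → y , r , proj₂ (S≡T y z) t })

module _ {Y : Set} where

  ｛_｝∩_ : Y → 𝒫 Y → 𝒫 Y
  (｛ a ｝∩ B) y = y ∈ ｛ a ｝ × a ∈ B

  ⋃-｛｝∩ : {A B : 𝒫 Y} → B ⊆ A → B ≐ ⋃ A (｛_｝∩ B)
  ⋃-｛｝∩ B⊆A = (λ y y∈B → y , B⊆A y y∈B , refl , y∈B)
              , (λ { y (a , _ , refl , a∈B) → a∈B })

  ∗⇒Ω⌣ : {S : MRel Y Y} →
         ((a : Y) (C : 𝒫 Y) → S a C → C ⊆ ｛ a ｝) → ∀ A B → (S ∗) A B → (Ω ⌣) A B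
  ∗⇒Ω⌣ S⊆pts A B (f , f⊆S , lift (B⊆⋃ , _)) =
    lift λ y y∈B → ⋃⊆A y (B⊆⋃ y y∈B)
    where
    ⋃⊆A : ⋃ A f ⊆ A
    ⋃⊆A y (a , a∈A , y∈fa) = subst A (sym (S⊆pts a (f a) (f⊆S a a∈A) y y∈fa)) a∈A

  Ω⌣⇒∗ : {S : MRel Y Y} →
         ((a : Y) (C : 𝒫 Y) → C ⊆ ｛ a ｝ → S a C) → ∀ A B → (Ω ⌣) A B → (S ∗) A B
  Ω⌣⇒∗ pts⊆S A B (lift B⊆A) =
    (｛_｝∩ B) , (λ a _ → pts⊆S a (｛ a ｝∩ B) (λ _ → proj₁)) , lift (⋃-｛｝∩ B⊆A)

  ↓𝟏⇒⊆｛｝ : (a : Y) (C : 𝒫 Y) → ↓ 𝟏 a C → C ⊆ ｛ a ｝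
  ↓𝟏⇒⊆｛｝ a C (D , lift (D⊆｛a｝ , _) , lift C⊆D) y y∈C = D⊆｛a｝ y (C⊆D y y∈C)

  ⊆｛｝⇒↓𝟏 : (a : Y) (C : 𝒫 Y) → C ⊆ ｛ a ｝ → ↓ 𝟏 a C
  ⊆｛｝⇒↓𝟏 a C C⊆｛a｝ = ｛ a ｝ , lift ((λ _ p → p) , (λ _ p → p)) , lift C⊆｛a｝

  𝟏∪𝟏⋓⇒⊆｛｝ : (a : Y) (C : 𝒫 Y) → (𝟏 ∪ 𝟏⋓ {Y}) a C → C ⊆ ｛ a ｝
  𝟏∪𝟏⋓⇒⊆｛｝ a C (inj₁ (lift (C⊆｛a｝ , _))) = C⊆｛a｝
  𝟏∪𝟏⋓⇒⊆｛｝ a C (inj₂ (lift (C⊆∅ , _)))     = λ y y∈C → ⊥-elim (C⊆∅ y y∈C)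

  ⊆｛｝⇒𝟏∪𝟏⋓ : ExcludedMiddle 0ℓ → (a : Y) (C : 𝒫 Y) → C ⊆ ｛ a ｝ → (𝟏 ∪ 𝟏⋓ {Y}) a C
  ⊆｛｝⇒𝟏∪𝟏⋓ em a C C⊆｛a｝ with em {a ∈ C}
  ... | yes a∈C = inj₁ (lift (C⊆｛a｝ , λ { y refl → a∈C }))
  ... | no a∉C  = inj₂ (lift ((λ y y∈C → a∉C (subst C (C⊆｛a｝ y y∈C) y∈C)) , λ y ()))

  ↓𝟏∗≡Ω⌣ : (↓ (𝟏 {Y})) ∗ ≡ᴿ Ω ⌣
  ↓𝟏∗≡Ω⌣ A B = ∗⇒Ω⌣ ↓𝟏⇒⊆｛｝ A B , Ω⌣⇒∗ ⊆｛｝⇒↓𝟏 A B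

  𝟏∪𝟏⋓∗≡Ω⌣ : ExcludedMiddle 0ℓ → (𝟏 {Y} ∪ 𝟏⋓) ∗ ≡ᴿ Ω ⌣
  𝟏∪𝟏⋓∗≡Ω⌣ em A B = ∗⇒Ω⌣ 𝟏∪𝟏⋓⇒⊆｛｝ A B , Ω⌣⇒∗ (⊆｛｝⇒𝟏∪𝟏⋓ em) A B

lemma4p6 : ExcludedMiddle 0ℓ → (Y : Set) →
    ((↓ (𝟏 {Y})) ∗ ≡ᴿ (𝟏 {Y} ∪ 𝟏⋓) ∗) ×
    ((𝟏 {Y} ∪ 𝟏⋓) ∗ ≡ᴿ (Ω ⌣)) ×
    (∀ (X : Set) (R : MRel X Y) → ↓ R ≡ᴿ (R ✶ ↓ 𝟏))
lemma4p6 em Y =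
    ≡ᴿ-trans ↓𝟏∗≡Ω⌣ (≡ᴿ-sym (𝟏∪𝟏⋓∗≡Ω⌣ em))
  , 𝟏∪𝟏⋓∗≡Ω⌣ em
  , λ X R → ⨾-congˡ R (≡ᴿ-sym ↓𝟏∗≡Ω⌣)
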